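{- Assume the jobs of a UJSSP instance are numbered in non-increasing order of $Z_j$. Consider the mixed-integer linear program $$\max \sum_{j=1}^n (r_jP_j-c_jx_j)$$ subject to $P_j\le \pi_jx_j$ for all $j\in\{1,\dots,n\}$; $P_j\le \pi_j(P_i+1-x_i)$ for all $i,j\in\{1,\dots,n\}$ with $i<j$; $x_j\in\{0,1\}$ and $P_j\ge 0$ for all $j$. Then its optimal value equals $\max_{S\subseteq J}z(S)$, and for any optimal solution $(x,P)$ the set $S=\{j: x_j=1\}$ is an optimal solution of UJSSP.
   Context: UJSSP (Unreliable Job Selection and Sequencing Problem): there is a set $J=\{1,\dots,n\}$ of jobs; job $j$ has a cost $c_j\ge 0$, a reward $r_j\ge 0$, and a success probability $\pi_j\in[0,1]$. For a subset $S\subseteq J$ and a sequence $\sigma$ of the jobs of $S$ (with $\sigma(k)$ the $k$-th job), the expected net profit is $z(S,\sigma)=\sum_{k=1}^{|S|} r_{\sigma(k)}\prod_{i=1}^{k}\pi_{\sigma(i)}-\sum_{j\in S}c_j$. Let $z(S)=\max_\sigma z(S,\sigma)$ (with $z(\emptyset)=0$). UJSSP asks for $S\subseteq J$ maximizing $z(S)$. The index of job $j$ is $Z_j=\pi_jr_j/(1-\pi_j)$ (taken as $+\infty$ if $\pi_j=1$).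
   Formalization: The costs $c_j$, rewards $r_j$ and success probabilities $\pi_j$ are rational, and the continuous variables $P_j$ of the mixed-integer program take values in ℚ. -}

module Defs where

open import Data.Nat using (ℕ; zero; suc)
open import Data.Fin using (Fin; zero; suc)
open import Data.Bool using (Bool; true; false)
open import Data.List using (List; []; _∷_)
open import Data.List.Membership.Propositional using (_∈_)
open import Data.List.Relation.Unary.Unique.Propositional using (Unique)
open import Data.Product using (Σ; ∃; _×_; _,_)
open import Data.Rational using (ℚ; 0ℚ; 1ℚ; _+_; _*_; _-_; _÷_; _≤_; ≢-nonZero)
open import Data.Rational.Properties using (_≟_)
open import Relation.Nullary using (yes; no)
open import Relation.Binary.PropositionalEquality using (_≡_)
open import Function.Bundles using (_⇔_)

sumFin : {n : ℕ} → (Fin n → ℚ) → ℚ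
sumFin {zero}  f = 0ℚ
sumFin {suc n} f = f zero + sumFin (λ i → f (suc i))

⟦_⟧ : Bool → ℚ
⟦ true ⟧  = 1ℚ
⟦ false ⟧ = 0ℚ

-- A UJSSP instance with n jobs: cost, reward, success probability.
record Instance (n : ℕ) : Set where
  field
    c : Fin n → ℚ
    r : Fin n → ℚ
    π : Fin n → ℚ

record Valid {n : ℕ} (I : Instance n) : Set where
  open Instance I
  field
    c≥0 : ∀ j → 0ℚ ≤ c j
    r≥0 : ∀ j → 0ℚ ≤ r j
    π≥0 : ∀ j → 0ℚ ≤ π j
    π≤1 : ∀ j → π j ≤ 1ℚ

data ℚ∞ : Set where
  fin : ℚ → ℚ∞
  ∞   : ℚ∞

data _≤∞_ : ℚ∞ → ℚ∞ → Set where
  fin≤fin : ∀ {p q} → p ≤ q → fin p ≤∞ fin q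
  any≤∞ : ∀ {x} → x ≤∞ ∞

Z : {n : ℕ} → Instance n → Fin n → ℚ∞
Z I j with (1ℚ - Instance.π I j) ≟ 0ℚ
... | yes _  = ∞
... | no ne = fin (_÷_ (Instance.π I j * Instance.r I j) (1ℚ - Instance.π I j) {{≢-nonZero ne}})

SortedByIndex : {n : ℕ} → Instance n → Set
SortedByIndex {n} I = ∀ (i j : Fin n) → i Data.Fin.< j → Z I j ≤∞ Z I i

Subset : ℕ → Set
Subset n = Fin n → Bool

IsSequenceOf : {n : ℕ} → List (Fin n) → Subset n → Set
IsSequenceOf {n} σ S = Unique σ × (∀ (j : Fin n) → (j ∈ σ) ⇔ (S j ≡ true))

-- Σ_k r_{σ(k)} Π_{i≤k} π_{σ(i)}, computed with the running product p of the earlier π's.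
rewardFrom : {n : ℕ} → Instance n → ℚ → List (Fin n) → ℚ
rewardFrom I p [] = 0ℚ
rewardFrom I p (j ∷ σ) =
  Instance.r I j * (p * Instance.π I j) + rewardFrom I (p * Instance.π I j) σ

costOf : {n : ℕ} → Instance n → Subset n → ℚ
costOf I S = sumFin (λ j → Instance.c I j * ⟦ S j ⟧)

zSeq : {n : ℕ} → Instance n → Subset n → List (Fin n) → ℚ
zSeq I S σ = rewardFrom I 1ℚ σ - costOf I S

IsZ : {n : ℕ} → Instance n → Subset n → ℚ → Set
IsZ I S v =
  (Σ (List _) λ σ → IsSequenceOf σ S × zSeq I S σ ≡ v) ×
  (∀ σ → IsSequenceOf σ S → zSeq I S σ ≤ v)

UJSSPOptimal : {n : ℕ} → Instance n → Subset n → Set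
UJSSPOptimal {n} I S =
  Σ ℚ λ v → IsZ I S v × (∀ (T : Subset n) (w : ℚ) → IsZ I T w → w ≤ v)

IsUJSSPOptValue : {n : ℕ} → Instance n → ℚ → Set
IsUJSSPOptValue {n} I V =
  (Σ (Subset n) λ S → IsZ I S V) × (∀ (T : Subset n) (w : ℚ) → IsZ I T w → w ≤ V)

MILPFeasible : {n : ℕ} → Instance n → (Fin n → Bool) → (Fin n → ℚ) → Set
MILPFeasible {n} I x P =
  (∀ j → P j ≤ Instance.π I j * ⟦ x j ⟧) ×
  (∀ (i j : Fin n) → i Data.Fin.< j →
     P j ≤ Instance.π I j * ((P i + 1ℚ) - ⟦ x i ⟧)) ×
  (∀ j → 0ℚ ≤ P j)

MILPObjective : {n : ℕ} → Instance n → (Fin n → Bool) → (Fin n → ℚ) → ℚ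
MILPObjective I x P = sumFin (λ j → Instance.r I j * P j - Instance.c I j * ⟦ x j ⟧)

MILPOptimal : {n : ℕ} → Instance n → (Fin n → Bool) → (Fin n → ℚ) → Set
MILPOptimal I x P =
  MILPFeasible I x P ×
  (∀ x′ P′ → MILPFeasible I x′ P′ → MILPObjective I x′ P′ ≤ MILPObjective I x P)

IsMILPOptValue : {n : ℕ} → Instance n → ℚ → Set
IsMILPOptValue I V =
  (Σ _ λ x → Σ _ λ P → MILPFeasible I x P × MILPObjective I x P ≡ V) ×
  (∀ x P → MILPFeasible I x P → MILPObjective I x P ≤ V)

module Submission where

-- Exchanging adjacent jobs a, b with Z_a ≤ Z_b so that b runs first never lowers the expected
-- reward, so every set S is best sequenced in index order and z(S) is the reward Σ_j r_j P_j of
-- that order minus the cost of S, where P_j is the probability that j is run and succeeds.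
-- For a fixed selection x, the MILP constraints give P_j ≤ 0 for unselected j and P_j ≤ π_j P_i
-- for selected i < j, so P_j is at most that success probability, which is itself feasible.
-- Hence the MILP and UJSSP maximise the same function over the finitely many subsets.

open import Algebra.Bundles using (CommutativeMonoid)
import Algebra.Properties.CommutativeSemigroup as CommSemigroupProperties
open import Data.Bool using (true; false; if_then_else_)
open import Data.Fin using (Fin; zero; suc; _<_)
import Data.Fin as Fin
open import Data.Empty using (⊥-elim)
open import Data.Fin.Properties using (suc-injective)
open import Data.List using (List; []; _∷_; map)
open import Data.List.Membership.Propositional using (_∈_; _∉_)
open import Data.List.Membership.Propositional.Properties using (∈-map⁺; ∈-map⁻)
open import Data.List.Relation.Unary.All.Properties using (¬Any⇒All¬; All¬⇒¬Any)
open import Data.List.Relation.Unary.AllPairs using ([]; _∷_)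
open import Data.List.Relation.Unary.Any using (here; there)
open import Data.List.Relation.Unary.Unique.Propositional using (Unique)
open import Data.List.Relation.Unary.Unique.Propositional.Properties using (map⁺)
open import Data.Nat using (ℕ; zero; suc; s≤s; z≤n)
open import Data.Product using (Σ; _×_; _,_; proj₁; proj₂)
open import Data.Rational
  using (ℚ; 0ℚ; 1ℚ; _+_; _*_; _-_; -_; _≤_; _÷_; 1/_; NonZero; ≢-nonZero; nonNegative)
open import Data.Rational.Properties
open import Data.Sum using (inj₁; inj₂)
open import Data.Vec.Functional using (tail)
import Data.Vec.Functional as Vector
open import Function using (_∘_)
open import Function.Bundles using (_⇔_; Equivalence; mk⇔)
open import Level using (0ℓ)
open import Relation.Binary.PropositionalEquality
open import Relation.Nullary using (contradiction)
open import Relation.Nullary.Decidable using (yes; no; dec⇒maybe)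
open import Tactic.RingSolver using (solve-∀)
open import Tactic.RingSolver.Core.AlmostCommutativeRing using (AlmostCommutativeRing; fromCommutativeRing)

open import Defs
open Instance
open Valid
open CommSemigroupProperties (CommutativeMonoid.commutativeSemigroup *-1-commutativeMonoid)
  using (xy∙z≈xz∙y)

ℚ-ring : AlmostCommutativeRing 0ℓ 0ℓ
ℚ-ring = fromCommutativeRing +-*-commutativeRing (λ p → dec⇒maybe (0ℚ ≟ p))

*-monoˡ-≤-0≤ : ∀ {p q r} → 0ℚ ≤ r → p ≤ q → r * p ≤ r * q
*-monoˡ-≤-0≤ {r = r} 0≤r = *-monoˡ-≤-nonNeg r {{nonNegative 0≤r}}

*-monoʳ-≤-0≤ : ∀ {p q r} → 0ℚ ≤ r → p ≤ q → p * r ≤ q * r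
*-monoʳ-≤-0≤ {r = r} 0≤r = *-monoʳ-≤-nonNeg r {{nonNegative 0≤r}}

0≤* : ∀ {p q} → 0ℚ ≤ p → 0ℚ ≤ q → 0ℚ ≤ p * q
0≤* {p} 0≤p 0≤q = ≤-trans (≤-reflexive (sym (*-zeroʳ p))) (*-monoˡ-≤-0≤ 0≤p 0≤q)

p*q≤p : ∀ {p q} → 0ℚ ≤ p → q ≤ 1ℚ → p * q ≤ p
p*q≤p {p} 0≤p q≤1 = ≤-trans (*-monoˡ-≤-0≤ 0≤p q≤1) (≤-reflexive (*-identityʳ p))

p≤1⇒0≤1-p : ∀ {p} → p ≤ 1ℚ → 0ℚ ≤ 1ℚ - p
p≤1⇒0≤1-p {p} p≤1 = ≤-trans (≤-reflexive (sym (+-inverseʳ p))) (+-monoˡ-≤ (- p) p≤1)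

0≤1 : 0ℚ ≤ 1ℚ
0≤1 = nonNegative⁻¹ 1ℚ

÷-*-cancel : ∀ p d .{{_ : NonZero d}} → (p ÷ d) * d ≡ p
÷-*-cancel p d = begin
  (p ÷ d) * d   ≡⟨ *-assoc p _ d ⟩
  p * (1/ d * d) ≡⟨ cong (p *_) (*-inverseˡ d) ⟩
  p * 1ℚ        ≡⟨ *-identityʳ p ⟩
  p             ∎
  where open ≡-Reasoning

⟦⟧≤1 : ∀ b → ⟦ b ⟧ ≤ 1ℚ
⟦⟧≤1 true  = ≤-refl
⟦⟧≤1 false = 0≤1

p*0+q≡q : ∀ p q → p * 0ℚ + q ≡ q
p*0+q≡q p q = trans (cong (_+ q) (*-zeroʳ p)) (+-identityˡ q)

p+1-⟦true⟧≡p : ∀ p → (p + 1ℚ) - ⟦ true ⟧ ≡ p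
p+1-⟦true⟧≡p = solve-∀ ℚ-ring

sumFin-cong : ∀ {n} {f g : Fin n → ℚ} → f ≗ g → sumFin f ≡ sumFin g
sumFin-cong {zero}  f≗g = refl
sumFin-cong {suc n} f≗g = cong₂ _+_ (f≗g zero) (sumFin-cong (f≗g ∘ suc))

sumFin-sub : ∀ {n} (f g : Fin n → ℚ) → sumFin (λ j → f j - g j) ≡ sumFin f - sumFin g
sumFin-sub {zero}  f g = refl
sumFin-sub {suc n} f g = begin
  (f zero - g zero) + sumFin (λ j → f (suc j) - g (suc j))
    ≡⟨ cong ((f zero - g zero) +_) (sumFin-sub (f ∘ suc) (g ∘ suc)) ⟩
  (f zero - g zero) + (sumFin (f ∘ suc) - sumFin (g ∘ suc))
    ≡⟨ regroup (f zero) (g zero) (sumFin (f ∘ suc)) (sumFin (g ∘ suc)) ⟩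
  (f zero + sumFin (f ∘ suc)) - (g zero + sumFin (g ∘ suc)) ∎
  where
  open ≡-Reasoning
  regroup : ∀ a b s t → (a - b) + (s - t) ≡ (a + s) - (b + t)
  regroup = solve-∀ ℚ-ring

Maximiser : ∀ {n} → (Subset n → ℚ) → Subset n → Set
Maximiser f x* = ∀ x → f x ≤ f x*

-- Subsets are functions, so without function extensionality f has to respect pointwise equality.
argmax : ∀ {n} (f : Subset n → ℚ) → (∀ {x y} → x ≗ y → f x ≡ f y) → Σ (Subset n) (Maximiser f)
argmax {zero}  f f-cong = (λ ()) , λ x → ≤-reflexive (f-cong (λ ()))
argmax {suc n} f f-cong = larger (argmax-with false) (argmax-with true)
  where
  cons-cong : ∀ b {x y : Subset n} → x ≗ y → (b Vector.∷ x) ≗ (b Vector.∷ y)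
  cons-cong b x≗y zero    = refl
  cons-cong b x≗y (suc j) = x≗y j

  argmax-with : ∀ b → Σ (Subset n) (Maximiser (f ∘ (b Vector.∷_)))
  argmax-with b = argmax (f ∘ (b Vector.∷_)) (f-cong ∘ cons-cong b)

  head∷tail : ∀ (x : Subset (suc n)) → x ≗ (x zero Vector.∷ tail x)
  head∷tail x zero    = refl
  head∷tail x (suc j) = refl

  bounded-by : ∀ {x*} → (∀ b y → f (b Vector.∷ y) ≤ f x*) → Maximiser f x*
  bounded-by bound x = ≤-trans (≤-reflexive (f-cong (head∷tail x))) (bound (x zero) (tail x))

  larger : Σ (Subset n) (Maximiser (f ∘ (false Vector.∷_))) →
           Σ (Subset n) (Maximiser (f ∘ (true Vector.∷_))) → Σ (Subset (suc n)) (Maximiser f)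
  larger (y₀ , max₀) (y₁ , max₁) with ≤-total (f (false Vector.∷ y₀)) (f (true Vector.∷ y₁))
  ... | inj₁ f₀≤f₁ = true Vector.∷ y₁ ,
    bounded-by λ { false y → ≤-trans (max₀ y) f₀≤f₁ ; true y → max₁ y }
  ... | inj₂ f₁≤f₀ = false Vector.∷ y₀ ,
    bounded-by λ { false y → max₀ y ; true y → ≤-trans (max₁ y) f₁≤f₀ }

tailInstance : ∀ {n} → Instance (suc n) → Instance n
tailInstance I = record { c = tail (c I) ; r = tail (r I) ; π = tail (π I) }

tailValid : ∀ {n} {I : Instance (suc n)} → Valid I → Valid (tailInstance I)
tailValid V = record
  { c≥0 = c≥0 V ∘ suc ; r≥0 = r≥0 V ∘ suc ; π≥0 = π≥0 V ∘ suc ; π≤1 = π≤1 V ∘ suc }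

Z-tail : ∀ {n} (I : Instance (suc n)) j → Z (tailInstance I) j ≡ Z I (suc j)
Z-tail I j with (1ℚ - π I (suc j)) ≟ 0ℚ
... | yes _ = refl
... | no _  = refl

tailSorted : ∀ {n} {I : Instance (suc n)} → SortedByIndex I → SortedByIndex (tailInstance I)
tailSorted {I = I} sorted i j i<j =
  subst₂ _≤∞_ (sym (Z-tail I j)) (sym (Z-tail I i)) (sorted (suc i) (suc j) (s≤s i<j))

-- P_j when the jobs of x run in index order and job 0 is reached with probability q.
successProb : ∀ {n} → Instance n → Subset n → ℚ → Fin n → ℚ
successProb I x q zero    = if x zero then q * π I zero else 0ℚ
successProb I x q (suc j) = successProb (tailInstance I) (tail x) (if x zero then q * π I zero else q) j

indexOrderReward : ∀ {n} → Instance n → Subset n → ℚ → ℚ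
indexOrderReward I x q = sumFin (λ j → r I j * successProb I x q j)

index-≤⇒cross-≤ : ∀ {n} (I : Instance n) → Valid I → ∀ a b → Z I a ≤∞ Z I b →
  (π I a * r I a) * (1ℚ - π I b) ≤ (π I b * r I b) * (1ℚ - π I a)
index-≤⇒cross-≤ I V a b Za≤Zb with (1ℚ - π I a) ≟ 0ℚ | (1ℚ - π I b) ≟ 0ℚ
... | yes da≡0 | yes db≡0 rewrite da≡0 | db≡0 =
  ≤-reflexive (trans (*-zeroʳ (π I a * r I a)) (sym (*-zeroʳ (π I b * r I b))))
... | no _ | yes db≡0 rewrite db≡0 =
  ≤-trans (≤-reflexive (*-zeroʳ (π I a * r I a)))
          (0≤* (0≤* (π≥0 V b) (r≥0 V b)) (p≤1⇒0≤1-p (π≤1 V a)))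
index-≤⇒cross-≤ I V a b () | yes _ | no _
index-≤⇒cross-≤ I V a b (fin≤fin Za≤Zb) | no da≢0 | no db≢0 = begin
  ua * db                  ≡⟨ cong (_* db) (÷-*-cancel ua da) ⟨
  (ua ÷ da) * da * db      ≡⟨ *-assoc (ua ÷ da) da db ⟩
  (ua ÷ da) * (da * db)    ≤⟨ *-monoʳ-≤-0≤ (0≤* (p≤1⇒0≤1-p (π≤1 V a)) (p≤1⇒0≤1-p (π≤1 V b))) Za≤Zb ⟩
  (ub ÷ db) * (da * db)    ≡⟨ cong ((ub ÷ db) *_) (*-comm da db) ⟩
  (ub ÷ db) * (db * da)    ≡⟨ *-assoc (ub ÷ db) db da ⟨
  (ub ÷ db) * db * da      ≡⟨ cong (_* da) (÷-*-cancel ub db) ⟩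
  ub * da                  ∎
  where
  open ≤-Reasoning
  ua ub da db : ℚ
  ua = π I a * r I a
  ub = π I b * r I b
  da = 1ℚ - π I a
  db = 1ℚ - π I b
  instance
    _ : NonZero da
    _ = ≢-nonZero da≢0
    _ : NonZero db
    _ = ≢-nonZero db≢0

adjacent-interchange : ∀ {n} (I : Instance n) → Valid I →
  ∀ a b {q} → Z I a ≤∞ Z I b → 0ℚ ≤ q →
  r I a * (q * π I a) + r I b * ((q * π I a) * π I b) ≤
  r I b * (q * π I b) + r I a * ((q * π I b) * π I a)
adjacent-interchange I V a b {q} Za≤Zb 0≤q = begin
  r I a * (q * π I a) + r I b * ((q * π I a) * π I b)
    ≡⟨ a-first q (π I a) (π I b) (r I a) (r I b) ⟩
  q * ((π I a * r I a) * (1ℚ - π I b)) + both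
    ≤⟨ +-monoˡ-≤ both (*-monoˡ-≤-0≤ 0≤q (index-≤⇒cross-≤ I V a b Za≤Zb)) ⟩
  q * ((π I b * r I b) * (1ℚ - π I a)) + both
    ≡⟨ b-first q (π I a) (π I b) (r I a) (r I b) ⟩
  r I b * (q * π I b) + r I a * ((q * π I b) * π I a) ∎
  where
  open ≤-Reasoning
  both : ℚ
  both = q * (π I a * π I b) * (r I a + r I b)
  a-first : ∀ q pa pb ra rb →
    ra * (q * pa) + rb * ((q * pa) * pb) ≡ q * ((pa * ra) * (1ℚ - pb)) + q * (pa * pb) * (ra + rb)
  a-first = solve-∀ ℚ-ring
  b-first : ∀ q pa pb ra rb →
    q * ((pb * rb) * (1ℚ - pa)) + q * (pa * pb) * (ra + rb) ≡ rb * (q * pb) + ra * ((q * pb) * pa)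
  b-first = solve-∀ ℚ-ring

removeZero : ∀ {n} → List (Fin (suc n)) → List (Fin n)
removeZero []          = []
removeZero (zero ∷ τ)  = removeZero τ
removeZero (suc j ∷ τ) = j ∷ removeZero τ

∈-removeZero⁻ : ∀ {n} {j : Fin n} τ → j ∈ removeZero τ → suc j ∈ τ
∈-removeZero⁻ (zero ∷ τ)  j∈       = there (∈-removeZero⁻ τ j∈)
∈-removeZero⁻ (suc k ∷ τ) (here refl) = here refl
∈-removeZero⁻ (suc k ∷ τ) (there j∈) = there (∈-removeZero⁻ τ j∈)

∈-removeZero⁺ : ∀ {n} {j : Fin n} τ → suc j ∈ τ → j ∈ removeZero τ
∈-removeZero⁺ (zero ∷ τ)  (there j∈) = ∈-removeZero⁺ τ j∈
∈-removeZero⁺ (suc k ∷ τ) (here eq)  = here (suc-injective eq)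
∈-removeZero⁺ (suc k ∷ τ) (there j∈) = there (∈-removeZero⁺ τ j∈)

removeZero-unique : ∀ {n} {τ : List (Fin (suc n))} → Unique τ → Unique (removeZero τ)
removeZero-unique {τ = []}        []          = []
removeZero-unique {τ = zero ∷ τ}  (_ ∷ u)     = removeZero-unique u
removeZero-unique {τ = suc k ∷ τ} (k∉τ ∷ u) =
  ¬Any⇒All¬ _ (All¬⇒¬Any k∉τ ∘ ∈-removeZero⁻ τ) ∷ removeZero-unique u

removeZero-sequence : ∀ {n} {σ} {x : Subset (suc n)} →
  IsSequenceOf σ x → IsSequenceOf (removeZero σ) (tail x)
removeZero-sequence {σ = σ} (unique , members) = removeZero-unique unique , λ j →
  mk⇔ (Equivalence.to (members (suc j)) ∘ ∈-removeZero⁻ σ)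
      (∈-removeZero⁺ σ ∘ Equivalence.from (members (suc j)))

rewardFrom-removeZero : ∀ {n} (I : Instance (suc n)) {q τ} → zero ∉ τ →
  rewardFrom I q τ ≡ rewardFrom (tailInstance I) q (removeZero τ)
rewardFrom-removeZero I {τ = []}        0∉τ = refl
rewardFrom-removeZero I {τ = zero ∷ τ}  0∉τ = ⊥-elim (0∉τ (here refl))
rewardFrom-removeZero I {q} {suc j ∷ τ} 0∉τ =
  cong (r I (suc j) * (q * π I (suc j)) +_) (rewardFrom-removeZero I (0∉τ ∘ there))

rewardFrom-map-suc : ∀ {n} (I : Instance (suc n)) {q} γ →
  rewardFrom I q (map suc γ) ≡ rewardFrom (tailInstance I) q γ
rewardFrom-map-suc I      []      = refl
rewardFrom-map-suc I {q} (j ∷ γ) = cong (r I (suc j) * (q * π I (suc j)) +_) (rewardFrom-map-suc I γ)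

zero-first : ∀ {n} (I : Instance (suc n)) → Valid I → SortedByIndex I →
  ∀ {σ q} → Unique σ → zero ∈ σ → 0ℚ ≤ q →
  rewardFrom I q σ ≤ r I zero * (q * π I zero) + rewardFrom (tailInstance I) (q * π I zero) (removeZero σ)
zero-first I V sorted {zero ∷ σ} {q} (0∉σ ∷ _) _ _ =
  ≤-reflexive (cong (r I zero * (q * π I zero) +_) (rewardFrom-removeZero I (All¬⇒¬Any 0∉σ)))
zero-first I V sorted {suc b ∷ σ} {q} (_ ∷ unique) (there 0∈σ) 0≤q = begin
  r I (suc b) * qb + rewardFrom I qb σ
    ≤⟨ +-monoʳ-≤ (r I (suc b) * qb) (zero-first I V sorted unique 0∈σ (0≤* 0≤q (π≥0 V (suc b)))) ⟩
  r I (suc b) * qb + (r I zero * (qb * π I zero) + rest (qb * π I zero))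
    ≡⟨ +-assoc (r I (suc b) * qb) _ _ ⟨
  (r I (suc b) * qb + r I zero * (qb * π I zero)) + rest (qb * π I zero)
    ≤⟨ +-monoˡ-≤ (rest (qb * π I zero))
         (adjacent-interchange I V (suc b) zero (sorted zero (suc b) (s≤s z≤n)) 0≤q) ⟩
  (r I zero * q0 + r I (suc b) * (q0 * π I (suc b))) + rest (qb * π I zero)
    ≡⟨ cong (λ p → (r I zero * q0 + r I (suc b) * (q0 * π I (suc b))) + rest p) (xy∙z≈xz∙y q _ _) ⟩
  (r I zero * q0 + r I (suc b) * (q0 * π I (suc b))) + rest (q0 * π I (suc b))
    ≡⟨ +-assoc (r I zero * q0) _ _ ⟩
  r I zero * q0 + rewardFrom (tailInstance I) q0 (b ∷ removeZero σ) ∎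
  where
  open ≤-Reasoning
  qb q0 : ℚ
  qb = q * π I (suc b)
  q0 = q * π I zero
  rest : ℚ → ℚ
  rest p = rewardFrom (tailInstance I) p (removeZero σ)

rewardFrom≤indexOrderReward : ∀ {n} (I : Instance n) → Valid I → SortedByIndex I →
  ∀ {x σ q} → IsSequenceOf σ x → 0ℚ ≤ q → rewardFrom I q σ ≤ indexOrderReward I x q
rewardFrom≤indexOrderReward {zero} I V sorted {σ = []}    _ _ = ≤-refl
rewardFrom≤indexOrderReward {zero} I V sorted {σ = () ∷ _} _ _
rewardFrom≤indexOrderReward {suc n} I V sorted {x} {σ} {q} seq@(unique , members) 0≤q with x zero in x₀
... | true = begin
  rewardFrom I q σ
    ≤⟨ zero-first I V sorted unique (Equivalence.from (members zero) x₀) 0≤q ⟩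
  r I zero * (q * π I zero) + rewardFrom (tailInstance I) (q * π I zero) (removeZero σ)
    ≤⟨ +-monoʳ-≤ (r I zero * (q * π I zero))
         (rewardFrom≤indexOrderReward (tailInstance I) (tailValid V) (tailSorted sorted)
           (removeZero-sequence seq) (0≤* 0≤q (π≥0 V zero))) ⟩
  r I zero * (q * π I zero) + indexOrderReward (tailInstance I) (tail x) (q * π I zero) ∎
  where open ≤-Reasoning
... | false = begin
  rewardFrom I q σ
    ≡⟨ rewardFrom-removeZero I (λ 0∈σ →
         contradiction (trans (sym x₀) (Equivalence.to (members zero) 0∈σ)) λ ()) ⟩
  rewardFrom (tailInstance I) q (removeZero σ)
    ≤⟨ rewardFrom≤indexOrderReward (tailInstance I) (tailValid V) (tailSorted sorted)
         (removeZero-sequence seq) 0≤q ⟩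
  indexOrderReward (tailInstance I) (tail x) q
    ≡⟨ p*0+q≡q (r I zero) _ ⟨
  r I zero * 0ℚ + indexOrderReward (tailInstance I) (tail x) q ∎
  where open ≤-Reasoning

indexOrder : ∀ {n} → Subset n → List (Fin n)
indexOrder {zero}  x = []
indexOrder {suc n} x = if x zero then zero ∷ later else later
  where
  later : List (Fin (suc n))
  later = map suc (indexOrder (tail x))

zero∉map-suc : ∀ {n} (γ : List (Fin n)) → zero ∉ map suc γ
zero∉map-suc γ 0∈ with ∈-map⁻ Fin.suc 0∈
... | _ , _ , ()

suc∈map-suc⁻ : ∀ {n} {j : Fin n} {γ} → suc j ∈ map suc γ → j ∈ γ
suc∈map-suc⁻ j∈ with ∈-map⁻ Fin.suc j∈
... | _ , j∈γ , refl = j∈γ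

indexOrder-unique : ∀ {n} (x : Subset n) → Unique (indexOrder x)
indexOrder-unique {zero}  x = []
indexOrder-unique {suc n} x with x zero
... | true  = ¬Any⇒All¬ _ (zero∉map-suc _) ∷ map⁺ suc-injective (indexOrder-unique (tail x))
... | false = map⁺ suc-injective (indexOrder-unique (tail x))

∈-indexOrder : ∀ {n} (x : Subset n) j → j ∈ indexOrder x ⇔ x j ≡ true
∈-indexOrder {suc n} x zero with x zero
... | true  = mk⇔ (λ _ → refl) (λ _ → here refl)
... | false = mk⇔ (λ 0∈ → ⊥-elim (zero∉map-suc _ 0∈)) λ ()
∈-indexOrder {suc n} x (suc j) with x zero
... | true  = mk⇔ (λ { (here ()) ; (there j∈) → to (suc∈map-suc⁻ j∈) })
                  (there ∘ ∈-map⁺ suc ∘ from)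
  where open Equivalence (∈-indexOrder (tail x) j)
... | false = mk⇔ (to ∘ suc∈map-suc⁻) (∈-map⁺ suc ∘ from)
  where open Equivalence (∈-indexOrder (tail x) j)

indexOrder-sequence : ∀ {n} (x : Subset n) → IsSequenceOf (indexOrder x) x
indexOrder-sequence x = indexOrder-unique x , ∈-indexOrder x

rewardFrom-indexOrder : ∀ {n} (I : Instance n) x q → rewardFrom I q (indexOrder x) ≡ indexOrderReward I x q
rewardFrom-indexOrder {zero}  I x q = refl
rewardFrom-indexOrder {suc n} I x q with x zero
... | true  = cong (r I zero * (q * π I zero) +_)
                (trans (rewardFrom-map-suc I (indexOrder (tail x)))
                       (rewardFrom-indexOrder (tailInstance I) (tail x) (q * π I zero)))
... | false = trans (rewardFrom-map-suc I (indexOrder (tail x)))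
                (trans (rewardFrom-indexOrder (tailInstance I) (tail x) q) (sym (p*0+q≡q (r I zero) _)))

value : ∀ {n} → Instance n → Subset n → ℚ
value I x = indexOrderReward I x 1ℚ - costOf I x

value-isZ : ∀ {n} (I : Instance n) → Valid I → SortedByIndex I → ∀ x → IsZ I x (value I x)
value-isZ I V sorted x =
  (indexOrder x , indexOrder-sequence x , cong (_- costOf I x) (rewardFrom-indexOrder I x 1ℚ)) ,
  λ σ seq → +-monoˡ-≤ (- costOf I x) (rewardFrom≤indexOrderReward I V sorted seq 0≤1)

isZ⇒≤value : ∀ {n} (I : Instance n) → Valid I → SortedByIndex I →
  ∀ {x w} → IsZ I x w → w ≤ value I x
isZ⇒≤value I V sorted {x} ((σ , seq , refl) , _) = proj₂ (value-isZ I V sorted x) σ seq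

successProb-cong : ∀ {n} (I : Instance n) {x y} → x ≗ y →
  ∀ q j → successProb I x q j ≡ successProb I y q j
successProb-cong I x≗y q zero    rewrite x≗y zero = refl
successProb-cong I x≗y q (suc j) rewrite x≗y zero = successProb-cong (tailInstance I) (x≗y ∘ suc) _ j

value-cong : ∀ {n} (I : Instance n) {x y} → x ≗ y → value I x ≡ value I y
value-cong I x≗y = cong₂ _-_
  (sumFin-cong λ j → cong (r I j *_) (successProb-cong I x≗y 1ℚ j))
  (sumFin-cong λ j → cong (λ b → c I j * ⟦ b ⟧) (x≗y j))

successProb-nonNeg : ∀ {n} (I : Instance n) → Valid I →
  ∀ x {q} → 0ℚ ≤ q → ∀ j → 0ℚ ≤ successProb I x q j
successProb-nonNeg I V x 0≤q zero with x zero
... | true  = 0≤* 0≤q (π≥0 V zero)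
... | false = ≤-refl
successProb-nonNeg I V x 0≤q (suc j) with x zero
... | true  = successProb-nonNeg (tailInstance I) (tailValid V) (tail x) (0≤* 0≤q (π≥0 V zero)) j
... | false = successProb-nonNeg (tailInstance I) (tailValid V) (tail x) 0≤q j

successProb≤π*q : ∀ {n} (I : Instance n) → Valid I →
  ∀ x {q} → 0ℚ ≤ q → ∀ j → successProb I x q j ≤ π I j * q
successProb≤π*q I V x {q} 0≤q zero with x zero
... | true  = ≤-reflexive (*-comm q (π I zero))
... | false = 0≤* (π≥0 V zero) 0≤q
successProb≤π*q I V x {q} 0≤q (suc j) with x zero
... | true  = ≤-trans (successProb≤π*q (tailInstance I) (tailValid V) (tail x) (0≤* 0≤q (π≥0 V zero)) j)
                      (*-monoˡ-≤-0≤ (π≥0 V (suc j)) (p*q≤p 0≤q (π≤1 V zero)))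
... | false = successProb≤π*q (tailInstance I) (tailValid V) (tail x) 0≤q j

successProb-unselected : ∀ {n} (I : Instance n) x q j → x j ≡ false → successProb I x q j ≡ 0ℚ
successProb-unselected I x q zero    xj≡false rewrite xj≡false = refl
successProb-unselected I x q (suc j) xj≡false =
  successProb-unselected (tailInstance I) (tail x) _ j xj≡false

successProb≤π*⟦x⟧ : ∀ {n} (I : Instance n) → Valid I → ∀ x {q} → 0ℚ ≤ q → q ≤ 1ℚ →
  ∀ j → successProb I x q j ≤ π I j * ⟦ x j ⟧
successProb≤π*⟦x⟧ I V x 0≤q q≤1 j with x j in xj
... | true  = ≤-trans (successProb≤π*q I V x 0≤q j) (*-monoˡ-≤-0≤ (π≥0 V j) q≤1)
... | false = ≤-reflexive (trans (successProb-unselected I x _ j xj) (sym (*-zeroʳ (π I j))))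

successProb-pair-bound : ∀ {n} (I : Instance n) → Valid I → ∀ x {q} → 0ℚ ≤ q → q ≤ 1ℚ →
  ∀ i j → i < j → successProb I x q j ≤ π I j * ((successProb I x q i + 1ℚ) - ⟦ x i ⟧)
successProb-pair-bound I V x {q} 0≤q q≤1 zero (suc j) _ with x zero
... | true  = ≤-trans (successProb≤π*q (tailInstance I) (tailValid V) (tail x) (0≤* 0≤q (π≥0 V zero)) j)
                      (≤-reflexive (cong (π I (suc j) *_) (sym (p+1-⟦true⟧≡p (q * π I zero)))))
... | false = ≤-trans (successProb≤π*q (tailInstance I) (tailValid V) (tail x) 0≤q j)
                      (*-monoˡ-≤-0≤ (π≥0 V (suc j)) q≤1)
successProb-pair-bound I V x {q} 0≤q q≤1 (suc i) (suc j) (s≤s i<j) with x zero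
... | true  = successProb-pair-bound (tailInstance I) (tailValid V) (tail x)
                (0≤* 0≤q (π≥0 V zero)) (≤-trans (p*q≤p 0≤q (π≤1 V zero)) q≤1) i j i<j
... | false = successProb-pair-bound (tailInstance I) (tailValid V) (tail x) 0≤q q≤1 i j i<j

successProb-feasible : ∀ {n} (I : Instance n) → Valid I → ∀ x → MILPFeasible I x (successProb I x 1ℚ)
successProb-feasible I V x =
  successProb≤π*⟦x⟧ I V x 0≤1 ≤-refl ,
  successProb-pair-bound I V x 0≤1 ≤-refl ,
  successProb-nonNeg I V x 0≤1

successProb-objective : ∀ {n} (I : Instance n) x → MILPObjective I x (successProb I x 1ℚ) ≡ value I x
successProb-objective I x = sumFin-sub (λ j → r I j * successProb I x 1ℚ j) (λ j → c I j * ⟦ x j ⟧)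

module _ {n} (I : Instance n) (x : Subset n) {P : Fin n → ℚ} (feasible : MILPFeasible I x P) where

  unselected⇒P≤0 : ∀ {j} → x j ≡ false → P j ≤ 0ℚ
  unselected⇒P≤0 {j} xj≡false = ≤-trans (proj₁ feasible j)
    (≤-reflexive (trans (cong (λ b → π I j * ⟦ b ⟧) xj≡false) (*-zeroʳ (π I j))))

  selected⇒later-P≤ : ∀ {i j} → x i ≡ true → i < j → P j ≤ π I j * P i
  selected⇒later-P≤ {i} {j} xi≡true i<j = ≤-trans (proj₁ (proj₂ feasible) i j i<j)
    (≤-reflexive (cong (π I j *_)
      (trans (cong (λ b → (P i + 1ℚ) - ⟦ b ⟧) xi≡true) (p+1-⟦true⟧≡p (P i)))))

tailFeasible : ∀ {n} (I : Instance (suc n)) x {P} →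
  MILPFeasible I x P → MILPFeasible (tailInstance I) (tail x) (tail P)
tailFeasible I x (≤selection , ≤later , nonNeg) =
  ≤selection ∘ suc , (λ i j i<j → ≤later (suc i) (suc j) (s≤s i<j)) , nonNeg ∘ suc

feasible⇒reward≤ : ∀ {n} (I : Instance n) → Valid I → ∀ {x P q} → MILPFeasible I x P →
  (∀ j → P j ≤ π I j * q) → sumFin (λ j → r I j * P j) ≤ indexOrderReward I x q
feasible⇒reward≤ {zero}  I V feasible P≤πq = ≤-refl
feasible⇒reward≤ {suc n} I V {x} {P} {q} feasible P≤πq with x zero in x₀
... | true  = +-mono-≤ (*-monoˡ-≤-0≤ (r≥0 V zero) P₀≤qπ₀)
    (feasible⇒reward≤ (tailInstance I) (tailValid V) {tail x} (tailFeasible I x feasible)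
      λ j → ≤-trans (selected⇒later-P≤ I x feasible x₀ (s≤s z≤n))
                    (*-monoˡ-≤-0≤ (π≥0 V (suc j)) P₀≤qπ₀))
  where
  P₀≤qπ₀ : P zero ≤ q * π I zero
  P₀≤qπ₀ = ≤-trans (P≤πq zero) (≤-reflexive (*-comm (π I zero) q))
... | false = +-mono-≤ (*-monoˡ-≤-0≤ (r≥0 V zero) (unselected⇒P≤0 I x feasible x₀))
    (feasible⇒reward≤ (tailInstance I) (tailValid V) {tail x} (tailFeasible I x feasible) (P≤πq ∘ suc))

feasible⇒objective≤value : ∀ {n} (I : Instance n) → Valid I → ∀ {x P} →
  MILPFeasible I x P → MILPObjective I x P ≤ value I x
feasible⇒objective≤value I V {x} {P} feasible = begin
  MILPObjective I x P
    ≡⟨ sumFin-sub (λ j → r I j * P j) (λ j → c I j * ⟦ x j ⟧) ⟩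
  sumFin (λ j → r I j * P j) - costOf I x
    ≤⟨ +-monoˡ-≤ (- costOf I x) (feasible⇒reward≤ I V {x} feasible P≤π) ⟩
  value I x ∎
  where
  open ≤-Reasoning
  P≤π : ∀ j → P j ≤ π I j * 1ℚ
  P≤π j = ≤-trans (proj₁ feasible j) (*-monoˡ-≤-0≤ (π≥0 V j) (⟦⟧≤1 (x j)))

mainTheorem5 : (n : ℕ) (I : Instance n) → Valid I → SortedByIndex I →
    (Σ ℚ λ V → IsMILPOptValue I V × IsUJSSPOptValue I V) ×
    (∀ x P → MILPOptimal I x P → UJSSPOptimal I x)
mainTheorem5 n I valid sorted =
  ( value I x*
  , ( (x* , successProb I x* 1ℚ , successProb-feasible I valid x* , successProb-objective I x*)
    , λ x P feasible → ≤-trans (feasible⇒objective≤value I valid feasible) (maximal x))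
  , ( (x* , value-isZ I valid sorted x*)
    , λ T w isZ → ≤-trans (isZ⇒≤value I valid sorted isZ) (maximal T)))
  , λ x P (feasible , optimal) → value I x , value-isZ I valid sorted x , λ T w isZ → begin
      w                                         ≤⟨ isZ⇒≤value I valid sorted isZ ⟩
      value I T                                 ≤⟨ maximal T ⟩
      value I x*                                ≡⟨ successProb-objective I x* ⟨
      MILPObjective I x* (successProb I x* 1ℚ)  ≤⟨ optimal x* _ (successProb-feasible I valid x*) ⟩
      MILPObjective I x P                       ≤⟨ feasible⇒objective≤value I valid feasible ⟩
      value I x                                 ∎
  where
  open ≤-Reasoning
  x* : Subset n
  x* = proj₁ (argmax (value I) (value-cong I))
  maximal : Maximiser (value I) x*
  maximal = proj₂ (argmax (value I) (value-cong I))
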